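{- Let $\mathcal{C}$ be a standard closure system over a finite set $U$ with acyclic split $(U_1,U_2)$. Let $\mathcal{C}_1=\{C\cap U_1 : C\in\mathcal{C},\ U_2\subseteq C\}$ (a closure system over $U_1$) and $\mathcal{C}_2=\{C\in\mathcal{C}: C\subseteq U_2\}$ (a closure system over $U_2$), and let $\mathcal{M}$, $\mathcal{M}_1$, $\mathcal{M}_2$ be the sets of meet-irreducible elements of $\mathcal{C}$, $\mathcal{C}_1$, $\mathcal{C}_2$ respectively. Then $|\mathcal{M}|\ge|\mathcal{M}_1|+|\mathcal{M}_2|$ and \[\mathcal{M}=\{M_1\cup U_2 : M_1\in\mathcal{M}_1\}\ \cup\ \{C\in\max(\mathrm{Ext}(M_2)) : M_2\in\mathcal{M}_2\},\] where $\max(\mathrm{Ext}(M_2))$ denotes the inclusion-maximal elements of $\mathrm{Ext}(M_2)=\{C\in\mathcal{C}: C\cap U_2=M_2\}$.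
   Context: A closure system over $U$ is a family $\mathcal{C}$ of subsets of $U$ with $U\in\mathcal{C}$ and closed under intersection; with closure operator $\phi(X)=\bigcap\{C\in\mathcal{C}: X\subseteq C\}$ it is standard if $\phi(\{u\})\setminus\{u\}\in\mathcal{C}$ for every $u\in U$. A meet-irreducible element of a closure system $\mathcal{F}$ over a set $V$ is a closed set $M\neq V$ such that $M=C\cap C'$ with $C,C'\in\mathcal{F}$ implies $M=C$ or $M=C'$ (equivalently, $M$ has exactly one upper cover in $\mathcal{F}$). An implication over $U$ is written $A \to b$ with $A \subseteq U$ nonempty and $b \in U$; an implicational base is a finite set of implications; $\Sigma$ is an implicational base for $\mathcal{C}$ if $\mathcal{C}$ is exactly the family of $C\subseteq U$ such that $A\subseteq C$ implies $b\in C$ for all $A\to b\in\Sigma$. For $X\subseteq U$, $\Sigma[X]=\{A\to b\in\Sigma: A\cup\{b\}\subseteq X\}$, and $\Sigma[U_1,U_2]:=\Sigma\setminus(\Sigma[U_1]\cup\Sigma[U_2])$. A bipartition $(U_1,U_2)$ of $U$ into nonempty disjoint parts with $U_2\in\mathcal{C}$ is an acyclic split of $\mathcal{C}$ if there is an implicational base $\Sigma$ for $\mathcal{C}$ in which every premise is contained in $U_1$ or in $U_2$ and every $A\to b\in\Sigma[U_1,U_2]$ has $A\subseteq U_1$. -}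

module Defs where

open import Data.Nat using (ℕ)
open import Data.Fin using (Fin)
open import Data.Fin.Subset
  using (Subset; _∈_; _⊆_; _∩_; _∪_; ∁; ⊤; ⁅_⁆; _─_; Nonempty)
open import Data.List using (List; length)
open import Data.List.Relation.Unary.All using (All)
open import Data.List.Relation.Unary.Unique.Propositional using (Unique)
open import Data.List.Membership.Propositional using () renaming (_∈_ to _∈ₗ_)
open import Data.Product using (Σ; ∃; _×_; _,_; proj₁; proj₂)
open import Data.Sum using (_⊎_)
open import Relation.Binary.PropositionalEquality using (_≡_; _≢_)
open import Relation.Nullary using (¬_)

Family : ℕ → Set₁
Family n = Subset n → Set

module _ {n : ℕ} where

  -- Closure system over the whole ground set U = Fin n (U ∈ 𝒞, closed
  -- under intersection; for a finite ground set, binary intersections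
  -- together with U ∈ 𝒞 cover all intersections).
  record ClosureSystem (𝒞 : Family n) : Set where
    field
      top-closed : 𝒞 ⊤
      ∩-closed   : ∀ C C′ → 𝒞 C → 𝒞 C′ → 𝒞 (C ∩ C′)

  IsClosureOf : Family n → Subset n → Subset n → Set
  IsClosureOf 𝒞 X Y =
    (∀ {u} → u ∈ Y → ∀ C → 𝒞 C → X ⊆ C → u ∈ C) ×
    (∀ {u} → (∀ C → 𝒞 C → X ⊆ C → u ∈ C) → u ∈ Y)

  Standard : Family n → Set
  Standard 𝒞 = ∀ (u : Fin n) (Y : Subset n) → IsClosureOf 𝒞 ⁅ u ⁆ Y → 𝒞 (Y ─ ⁅ u ⁆)

  record Implication : Set where
    constructor _⇒_∣_
    field
      premise    : Subset n
      conclusion : Fin n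
      nonempty   : Nonempty premise
  open Implication public

  support : Implication → Subset n
  support i = premise i ∪ ⁅ conclusion i ⁆

  ImplicationalBase : Set
  ImplicationalBase = List Implication

  Satisfies : ImplicationalBase → Subset n → Set
  Satisfies Σ′ C = ∀ i → i ∈ₗ Σ′ → premise i ⊆ C → conclusion i ∈ C

  IsBaseFor : ImplicationalBase → Family n → Set
  IsBaseFor Σ′ 𝒞 = ∀ C → (𝒞 C → Satisfies Σ′ C) × (Satisfies Σ′ C → 𝒞 C)

  AcyclicSplit : Family n → Subset n → Subset n → Set
  AcyclicSplit 𝒞 U₁ U₂ =
    (U₁ ≡ ∁ U₂) × Nonempty U₁ × Nonempty U₂ × 𝒞 U₂ ×
    Σ ImplicationalBase λ Σ′ → IsBaseFor Σ′ 𝒞 ×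
      (∀ i → i ∈ₗ Σ′ → premise i ⊆ U₁ ⊎ premise i ⊆ U₂) ×
      -- every implication of Σ[U₁,U₂] (not in Σ[U₁] nor Σ[U₂]) has A ⊆ U₁
      (∀ i → i ∈ₗ Σ′ → ¬ (support i ⊆ U₁) → ¬ (support i ⊆ U₂) →
         premise i ⊆ U₁)

  MeetIrreducible : Subset n → Family n → Subset n → Set
  MeetIrreducible V F M =
    F M × M ≢ V ×
    (∀ C C′ → F C → F C′ → M ≡ C ∩ C′ → M ≡ C ⊎ M ≡ C′)

  𝒞₁ : Family n → Subset n → Subset n → Family n
  𝒞₁ 𝒞 U₁ U₂ X = ∃ λ C → 𝒞 C × U₂ ⊆ C × X ≡ C ∩ U₁

  𝒞₂ : Family n → Subset n → Family n
  𝒞₂ 𝒞 U₂ X = 𝒞 X × X ⊆ U₂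

  Ext : Family n → Subset n → Subset n → Family n
  Ext 𝒞 U₂ M₂ C = 𝒞 C × C ∩ U₂ ≡ M₂

  Max : Family n → Family n
  Max F C = F C × (∀ C′ → F C′ → C ⊆ C′ → C′ ≡ C)

HasCard : {A : Set} → (A → Set) → ℕ → Set
HasCard {A} P k =
  Σ (List A) λ xs → Unique xs × All P xs × (∀ x → P x → x ∈ₗ xs) × length xs ≡ k

-- Meet-irreducibles of 𝒞 containing U₂ are the meet-irreducibles of the upper
-- part {C ∈ 𝒞 : U₂ ⊆ C}, which C ↦ C ∩ U₁ maps ∩-isomorphically onto 𝒞₁.
-- For the others, the point is that every premise of the base lies in U₁ or in
-- U₂, so replacing the U₂-part of a closed M by a closed X ⊆ U₂ with M ∩ U₂ ⊆ X
-- gives a closed set (M ∩ U₁) ∪ X.  This lifts a decomposition of M ∩ U₂ in 𝒞₂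
-- to one of M in 𝒞, and (with X = U₂) shows that M is maximal in Ext(M ∩ U₂).
-- Conversely any decomposition of a maximal extension of a meet-irreducible M₂
-- traces down to one of M₂.  The two resulting maps into 𝓜 are injective with
-- disjoint images (only the first contains U₂), which gives the count.
module Submission where

open import Defs
open import Algebra.Bundles using (CommutativeMonoid)
open import Data.Bool.Properties using () renaming (_≟_ to _≟ᵇ_)
open import Data.Empty using (⊥-elim)
open import Data.Fin.Subset using (Subset; _∪_; ⊤; _⊆_; _⊈_; _⊃_; _∩_; ∁; ⊥)
open import Data.Fin.Subset.Induction using (Acc; acc; ⊃-wellFounded)
open import Data.Fin.Subset.Properties
open import Data.List using (List; []; _∷_; length; map; _++_)
open import Data.List.Properties using (length-removeAt′; length-++; length-map)
open import Data.List.Membership.Propositional using () renaming (_∈_ to _∈ₗ_)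
open import Data.List.Membership.Propositional.Properties using (∈-map⁻; ∈-++⁻)
open import Data.List.Relation.Unary.All as All using (All; []; _∷_)
import Data.List.Relation.Unary.All.Properties as Allₚ
open import Data.List.Relation.Unary.AllPairs using ([]; _∷_)
open import Data.List.Relation.Unary.Any using (here; there; index) renaming (_─_ to _─ₗ_)
open import Data.List.Relation.Unary.Unique.Propositional using (Unique)
open import Data.List.Relation.Unary.Unique.Propositional.Properties using (++⁺)
open import Data.Nat using (ℕ; _+_; _≤_; z≤n; s≤s)
open import Data.Product using (∃; _×_; _,_; proj₁; proj₂)
open import Data.Sum as Sum using (_⊎_; inj₁; inj₂)
open import Data.Vec.Properties using (≡-dec)
open import Function.Bundles using (_⇔_; mk⇔; Equivalence)
open import Relation.Binary.PropositionalEquality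
  using (_≡_; _≢_; refl; sym; trans; cong; cong₂; subst; module ≡-Reasoning)
open import Relation.Nullary using (¬_; Dec; yes; no; contradiction)
import Relation.Nullary.Decidable as Dec
open import Relation.Nullary.Decidable using (_×-dec_; _→-dec_)
open import Relation.Unary using (Decidable)

private
  variable
    A B : Set

∈-─⁺ : ∀ {x y : A} {xs} (x∈ : x ∈ₗ xs) → y ∈ₗ xs → y ≢ x → y ∈ₗ (xs ─ₗ x∈)
∈-─⁺ (here refl) (here refl) y≢x = contradiction refl y≢x
∈-─⁺ (here refl) (there y∈) _    = y∈
∈-─⁺ (there x∈)  (here refl) _   = here refl
∈-─⁺ (there x∈)  (there y∈) y≢x  = there (∈-─⁺ x∈ y∈ y≢x)

Unique⇒length≤ : ∀ {xs ys : List A} → Unique xs → All (_∈ₗ ys) xs → length xs ≤ length ys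
Unique⇒length≤ {xs = []} [] [] = z≤n
Unique⇒length≤ {xs = x ∷ xs} {ys} (x∉ ∷ u) (x∈ ∷ xs⊆) =
  subst (length (x ∷ xs) ≤_) (sym (length-removeAt′ ys (index x∈)))
    (s≤s (Unique⇒length≤ u (All.zipWith (λ (y≢x , y∈) → ∈-─⁺ x∈ y∈ y≢x)
                              (All.map (λ x≢y y≡x → x≢y (sym y≡x)) x∉ , xs⊆))))

Unique-map⁺ : ∀ {P : A → Set} {xs} (f : A → B) →
              (∀ {x y} → P x → P y → f x ≡ f y → x ≡ y) →
              All P xs → Unique xs → Unique (map f xs)
Unique-map⁺ f f-inj []         []         = []
Unique-map⁺ f f-inj (px ∷ pxs) (x∉ ∷ u) =
  Allₚ.map⁺ (All.zipWith (λ (py , x≢y) fx≡fy → x≢y (f-inj px py fx≡fy)) (pxs , x∉))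
    ∷ Unique-map⁺ f f-inj pxs u

HasCard-+-≤ : ∀ {P Q : A → Set} {R : B → Set} {k₁ k₂ k} (f g : A → B) →
              (∀ {x} → P x → R (f x)) → (∀ {x} → Q x → R (g x)) →
              (∀ {x y} → P x → P y → f x ≡ f y → x ≡ y) →
              (∀ {x y} → Q x → Q y → g x ≡ g y → x ≡ y) →
              (∀ {x y} → P x → Q y → f x ≢ g y) →
              HasCard R k → HasCard P k₁ → HasCard Q k₂ → k₁ + k₂ ≤ k
HasCard-+-≤ {B = B} {R = R} f g f∈R g∈R f-inj g-inj f≢g
  (zs , _ , _ , R⊆zs , refl)
  (xs , xs-unique , xs⊆P , _ , refl)
  (ys , ys-unique , ys⊆Q , _ , refl) =
  subst (_≤ length zs) length-images (Unique⇒length≤ images-unique (All.tabulate images⊆zs))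
  where
  images : List B
  images = map f xs ++ map g ys

  length-images : length images ≡ length xs + length ys
  length-images = trans (length-++ (map f xs)) (cong₂ _+_ (length-map f xs) (length-map g ys))

  images-disjoint : ∀ {v} → ¬ (v ∈ₗ map f xs × v ∈ₗ map g ys)
  images-disjoint (v∈fxs , v∈gys) with ∈-map⁻ f v∈fxs | ∈-map⁻ g v∈gys
  ... | x , x∈ , refl | y , y∈ , fx≡gy = f≢g (All.lookup xs⊆P x∈) (All.lookup ys⊆Q y∈) fx≡gy

  images-unique : Unique images
  images-unique = ++⁺ (Unique-map⁺ f f-inj xs⊆P xs-unique) (Unique-map⁺ g g-inj ys⊆Q ys-unique)
                      images-disjoint

  images⊆zs : ∀ {v} → v ∈ₗ images → v ∈ₗ zs
  images⊆zs v∈ with ∈-++⁻ (map f xs) v∈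
  ... | inj₁ v∈fxs = let x , x∈ , v≡fx = ∈-map⁻ f v∈fxs in
                     R⊆zs _ (subst R (sym v≡fx) (f∈R (All.lookup xs⊆P x∈)))
  ... | inj₂ v∈gys = let y , y∈ , v≡gy = ∈-map⁻ g v∈gys in
                     R⊆zs _ (subst R (sym v≡gy) (g∈R (All.lookup ys⊆Q y∈)))

module _ {n : ℕ} where
  open ≡-Reasoning
  open import Algebra.Properties.CommutativeSemigroup
    (CommutativeMonoid.commutativeSemigroup (∩-commutativeMonoid n)) using (interchange)

  p⊆q⇒p∩q≡p : {p q : Subset n} → p ⊆ q → p ∩ q ≡ p
  p⊆q⇒p∩q≡p {p} {q} p⊆q = ⊆-antisym (p∩q⊆p p q) (λ x∈p → x∈p∩q⁺ (x∈p , p⊆q x∈p))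

  p⊆q⇒q∩p≡p : {p q : Subset n} → p ⊆ q → q ∩ p ≡ p
  p⊆q⇒q∩p≡p {p} {q} p⊆q = trans (∩-comm q p) (p⊆q⇒p∩q≡p p⊆q)

  p∩∁q∪p∩q≡p : ∀ (p q : Subset n) → (p ∩ ∁ q) ∪ (p ∩ q) ≡ p
  p∩∁q∪p∩q≡p p q = begin
    (p ∩ ∁ q) ∪ (p ∩ q) ≡⟨ ∩-distribˡ-∪ p (∁ q) q ⟨
    p ∩ (∁ q ∪ q)       ≡⟨ cong (p ∩_) (∪-inverseˡ q) ⟩
    p ∩ ⊤               ≡⟨ ∩-identityʳ p ⟩
    p                   ∎

  ∩-distribʳ-∩ : ∀ (p q r : Subset n) → (p ∩ q) ∩ r ≡ (p ∩ r) ∩ (q ∩ r)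
  ∩-distribʳ-∩ p q r = begin
    (p ∩ q) ∩ r       ≡⟨ cong ((p ∩ q) ∩_) (∩-idem r) ⟨
    (p ∩ q) ∩ (r ∩ r) ≡⟨ interchange p q r r ⟩
    (p ∩ r) ∩ (q ∩ r) ∎

  p⊆∁r⇒[p∪q]∩r≡q : {p q r : Subset n} → p ⊆ ∁ r → q ⊆ r → (p ∪ q) ∩ r ≡ q
  p⊆∁r⇒[p∪q]∩r≡q {p} {q} {r} p⊆∁r q⊆r = begin
    (p ∪ q) ∩ r             ≡⟨ ∩-distribʳ-∪ r p q ⟩
    (p ∩ r) ∪ (q ∩ r)       ≡⟨ cong (_∪ (q ∩ r)) p∩r≡⊥ ⟩
    ⊥ ∪ (q ∩ r)             ≡⟨ ∪-identityˡ (q ∩ r) ⟩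
    q ∩ r                   ≡⟨ p⊆q⇒p∩q≡p q⊆r ⟩
    q                       ∎
    where
    p∩r≡⊥ : p ∩ r ≡ ⊥
    p∩r≡⊥ = begin
      p ∩ r           ≡⟨ cong (_∩ r) (p⊆q⇒p∩q≡p p⊆∁r) ⟨
      (p ∩ ∁ r) ∩ r   ≡⟨ ∩-assoc p (∁ r) r ⟩
      p ∩ (∁ r ∩ r)   ≡⟨ cong (p ∩_) (∩-inverseˡ r) ⟩
      p ∩ ⊥           ≡⟨ ∩-zeroʳ p ⟩
      ⊥               ∎

  p⊆∁q⇒[p∪q]∩∁q≡p : {p q : Subset n} → p ⊆ ∁ q → (p ∪ q) ∩ ∁ q ≡ p
  p⊆∁q⇒[p∪q]∩∁q≡p {p} {q} p⊆∁q = begin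
    (p ∪ q) ∩ ∁ q ≡⟨ cong (_∩ ∁ q) (∪-comm p q) ⟩
    (q ∪ p) ∩ ∁ q ≡⟨ p⊆∁r⇒[p∪q]∩r≡q (λ x∈q → x∉p⇒x∈∁p (x∈p⇒x∉∁p x∈q)) p⊆∁q ⟩
    p             ∎

  Above : Family n → Subset n → Family n
  Above F U C = F C × U ⊆ C

  MeetIrreducible-Above : ∀ {V F U M} → U ⊆ M →
                          MeetIrreducible V F M ⇔ MeetIrreducible V (Above F U) M
  MeetIrreducible-Above {V} {F} {U} {M} U⊆M = mk⇔ to from
    where
    to : MeetIrreducible V F M → MeetIrreducible V (Above F U) M
    to (FM , M≢V , irr) = (FM , U⊆M) , M≢V , λ C C′ (FC , _) (FC′ , _) → irr C C′ FC FC′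

    from : MeetIrreducible V (Above F U) M → MeetIrreducible V F M
    from ((FM , _) , M≢V , irr) = FM , M≢V , irr′
      where
      irr′ : ∀ C C′ → F C → F C′ → M ≡ C ∩ C′ → M ≡ C ⊎ M ≡ C′
      irr′ C C′ FC FC′ M≡C∩C′ =
        irr C C′ (FC , ⊆-trans U⊆C∩C′ (p∩q⊆p C C′)) (FC′ , ⊆-trans U⊆C∩C′ (p∩q⊆q C C′)) M≡C∩C′
        where
        U⊆C∩C′ : U ⊆ C ∩ C′
        U⊆C∩C′ = subst (U ⊆_) M≡C∩C′ U⊆M

  record ∩-Isomorphism (V : Subset n) (F : Family n) (W : Subset n) (G : Family n) : Set where
    field
      to from     : Subset n → Subset n
      to-closed   : ∀ {C} → F C → G (to C)
      from-closed : ∀ {D} → G D → F (from D)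
      from∘to     : ∀ {C} → F C → from (to C) ≡ C
      to∘from     : ∀ {D} → G D → to (from D) ≡ D
      to-∩        : ∀ {C C′} → F C → F C′ → to (C ∩ C′) ≡ to C ∩ to C′
      from-∩      : ∀ {D D′} → G D → G D′ → from (D ∩ D′) ≡ from D ∩ from D′
      to-top      : to V ≡ W
      from-top    : from W ≡ V

    reverse : ∩-Isomorphism W G V F
    reverse = record
      { to = from ; from = to ; to-closed = from-closed ; from-closed = to-closed
      ; from∘to = to∘from ; to∘from = from∘to ; to-∩ = from-∩ ; from-∩ = to-∩
      ; to-top = from-top ; from-top = to-top }

    from-injective : ∀ {D D′} → G D → G D′ → from D ≡ from D′ → D ≡ D′
    from-injective GD GD′ eq = trans (sym (to∘from GD)) (trans (cong to eq) (to∘from GD′))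

    MeetIrreducible-to : ∀ {M} → MeetIrreducible V F M → MeetIrreducible W G (to M)
    MeetIrreducible-to {M} (FM , M≢V , irr) = to-closed FM , toM≢W , irr′
      where
      toM≢W : to M ≢ W
      toM≢W toM≡W = M≢V (begin
        M           ≡⟨ from∘to FM ⟨
        from (to M) ≡⟨ cong from toM≡W ⟩
        from W      ≡⟨ from-top ⟩
        V           ∎)

      irr′ : ∀ D D′ → G D → G D′ → to M ≡ D ∩ D′ → to M ≡ D ⊎ to M ≡ D′
      irr′ D D′ GD GD′ toM≡D∩D′ =
        Sum.map (back GD) (back GD′)
          (irr (from D) (from D′) (from-closed GD) (from-closed GD′) M≡)
        where
        M≡ : M ≡ from D ∩ from D′
        M≡ = begin
          M               ≡⟨ from∘to FM ⟨
          from (to M)     ≡⟨ cong from toM≡D∩D′ ⟩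
          from (D ∩ D′)   ≡⟨ from-∩ GD GD′ ⟩
          from D ∩ from D′ ∎

        back : ∀ {E} → G E → M ≡ from E → to M ≡ E
        back GE M≡fromE = trans (cong to M≡fromE) (to∘from GE)

  Max-exists : ∀ {P : Family n} → Decidable P → ∀ {C} → P C → ∃ (Max P)
  Max-exists {P} P? {C} = go (⊃-wellFounded C)
    where
    go : ∀ {C} → Acc _⊃_ C → P C → ∃ (Max P)
    go {C} (acc rec) PC with anySubset? (λ C′ → P? C′ ×-dec C ⊂? C′)
    ... | yes (C′ , PC′ , C⊂C′) = go (rec C⊂C′) PC′
    ... | no ∄larger = C , PC , maximal
      where
      maximal : ∀ C′ → P C′ → C ⊆ C′ → C′ ≡ C
      maximal C′ PC′ C⊆C′ = ⊆-antisym C′⊆C C⊆C′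
        where
        C′⊆C : C′ ⊆ C
        C′⊆C {x} x∈C′ with x ∈? C
        ... | yes x∈C = x∈C
        ... | no x∉C = contradiction (C′ , PC′ , (λ {y} → C⊆C′ {y}) , x , x∈C′ , x∉C) ∄larger

  Satisfies? : ∀ (Σ′ : ImplicationalBase {n}) C → Dec (Satisfies Σ′ C)
  Satisfies? Σ′ C =
    Dec.map′ (λ all i i∈ → All.lookup all i∈) (λ sat → All.tabulate (λ {i} → sat i))
      (All.all? (λ i → premise i ⊆? C →-dec conclusion i ∈? C) Σ′)

  IsBaseFor⇒Decidable : ∀ {Σ′ 𝒞} → IsBaseFor Σ′ 𝒞 → Decidable 𝒞
  IsBaseFor⇒Decidable {Σ′} base C = Dec.map′ (proj₂ (base C)) (proj₁ (base C)) (Satisfies? Σ′ C)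

module SplitClosureSystem {n : ℕ} {𝒞 : Family n} {U : Subset n}
  (closure : ClosureSystem 𝒞) (𝒞U : 𝒞 U) {Σ′ : ImplicationalBase {n}} (base : IsBaseFor Σ′ 𝒞)
  (premise-split : ∀ i → i ∈ₗ Σ′ → premise i ⊆ ∁ U ⊎ premise i ⊆ U) where

  open ClosureSystem closure
  open ≡-Reasoning

  upper-iso : ∩-Isomorphism ⊤ (Above 𝒞 U) (∁ U) (𝒞₁ 𝒞 (∁ U) U)
  upper-iso = record
    { to          = _∩ ∁ U
    ; from        = _∪ U
    ; to-closed   = λ {C} (𝒞C , U⊆C) → C , 𝒞C , U⊆C , refl
    ; from-closed = λ { (C , 𝒞C , U⊆C , refl) → subst (Above 𝒞 U) (sym (restore U⊆C)) (𝒞C , U⊆C) }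
    ; from∘to     = λ (_ , U⊆C) → restore U⊆C
    ; to∘from     = λ { (C , _ , _ , refl) → p⊆∁q⇒[p∪q]∩∁q≡p (p∩q⊆q C (∁ U)) }
    ; to-∩        = λ {C} {C′} _ _ → ∩-distribʳ-∩ C C′ (∁ U)
    ; from-∩      = λ {D} {D′} _ _ → ∪-distribʳ-∩ U D D′
    ; to-top      = ∩-identityˡ (∁ U)
    ; from-top    = ∪-inverseˡ U
    }
    where
    restore : ∀ {C} → U ⊆ C → (C ∩ ∁ U) ∪ U ≡ C
    restore {C} U⊆C = begin
      (C ∩ ∁ U) ∪ U       ≡⟨ cong ((C ∩ ∁ U) ∪_) (p⊆q⇒q∩p≡p U⊆C) ⟨
      (C ∩ ∁ U) ∪ (C ∩ U) ≡⟨ p∩∁q∪p∩q≡p C U ⟩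
      C                   ∎

  module Upper = ∩-Isomorphism upper-iso

  union-MeetIrreducible : ∀ {M₁} → MeetIrreducible (∁ U) (𝒞₁ 𝒞 (∁ U) U) M₁ →
                          MeetIrreducible ⊤ 𝒞 (M₁ ∪ U)
  union-MeetIrreducible {M₁} MI₁ =
    Equivalence.from (MeetIrreducible-Above (q⊆p∪q M₁ U))
      (∩-Isomorphism.MeetIrreducible-to Upper.reverse MI₁)

  splice : Subset n → Subset n → Subset n
  splice M X = (M ∩ ∁ U) ∪ X

  ⊆-splice : ∀ {M X} → M ∩ U ⊆ X → M ⊆ splice M X
  ⊆-splice {M} {X} M∩U⊆X {x} x∈M with x ∈? U
  ... | yes x∈U = q⊆p∪q (M ∩ ∁ U) X (M∩U⊆X (x∈p∩q⁺ (x∈M , x∈U)))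
  ... | no x∉U  = p⊆p∪q X (x∈p∩q⁺ (x∈M , x∉p⇒x∈∁p x∉U))

  -- An implication with premise in ∁ U sees only the closed set M, one with
  -- premise in U sees only the closed set X ⊆ U.
  splice-closed : ∀ {M X} → 𝒞 M → 𝒞 X → X ⊆ U → M ∩ U ⊆ X → 𝒞 (splice M X)
  splice-closed {M} {X} 𝒞M 𝒞X X⊆U M∩U⊆X = proj₂ (base (splice M X)) satisfies
    where
    satisfies : Satisfies Σ′ (splice M X)
    satisfies i i∈Σ′ A⊆splice with premise-split i i∈Σ′
    ... | inj₁ A⊆∁U = ⊆-splice M∩U⊆X (proj₁ (base M) 𝒞M i i∈Σ′ A⊆M)
      where
      A⊆M : premise i ⊆ M
      A⊆M x∈A with x∈p∪q⁻ (M ∩ ∁ U) X (A⊆splice x∈A)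
      ... | inj₁ x∈M∩∁U = p∩q⊆p M (∁ U) x∈M∩∁U
      ... | inj₂ x∈X    = contradiction (X⊆U x∈X) (x∈∁p⇒x∉p (A⊆∁U x∈A))
    ... | inj₂ A⊆U = q⊆p∪q (M ∩ ∁ U) X (proj₁ (base X) 𝒞X i i∈Σ′ A⊆X)
      where
      A⊆X : premise i ⊆ X
      A⊆X x∈A with x∈p∪q⁻ (M ∩ ∁ U) X (A⊆splice x∈A)
      ... | inj₁ x∈M∩∁U = contradiction (A⊆U x∈A) (x∈∁p⇒x∉p (p∩q⊆q M (∁ U) x∈M∩∁U))
      ... | inj₂ x∈X    = x∈X

  splice-trace : ∀ {M X} → X ⊆ U → splice M X ∩ U ≡ X
  splice-trace {M} X⊆U = p⊆∁r⇒[p∪q]∩r≡q (p∩q⊆q M (∁ U)) X⊆U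

  splice-∩ : ∀ M X Y → splice M (X ∩ Y) ≡ splice M X ∩ splice M Y
  splice-∩ M = ∪-distribˡ-∩ (M ∩ ∁ U)

  splice-trace-self : ∀ M → splice M (M ∩ U) ≡ M
  splice-trace-self M = p∩∁q∪p∩q≡p M U

  trace-closed : ∀ {C} → 𝒞 C → 𝒞₂ 𝒞 U (C ∩ U)
  trace-closed {C} 𝒞C = ∩-closed C U 𝒞C 𝒞U , p∩q⊆q C U

  trace-MeetIrreducible : ∀ {M} → MeetIrreducible ⊤ 𝒞 M → U ⊈ M →
                          MeetIrreducible U (𝒞₂ 𝒞 U) (M ∩ U)
  trace-MeetIrreducible {M} (𝒞M , _ , irr) U⊈M = trace-closed 𝒞M , M∩U≢U , irr₂
    where
    M∩U≢U : M ∩ U ≢ U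
    M∩U≢U M∩U≡U = U⊈M (subst (_⊆ M) M∩U≡U (p∩q⊆p M U))

    irr₂ : ∀ X Y → 𝒞₂ 𝒞 U X → 𝒞₂ 𝒞 U Y → M ∩ U ≡ X ∩ Y → M ∩ U ≡ X ⊎ M ∩ U ≡ Y
    irr₂ X Y (𝒞X , X⊆U) (𝒞Y , Y⊆U) M∩U≡X∩Y =
      Sum.map (trace X⊆U) (trace Y⊆U)
        (irr (splice M X) (splice M Y) (splice-closed 𝒞M 𝒞X X⊆U (⊆-trans M∩U⊆X∩Y (p∩q⊆p X Y)))
             (splice-closed 𝒞M 𝒞Y Y⊆U (⊆-trans M∩U⊆X∩Y (p∩q⊆q X Y))) M≡)
      where
      M∩U⊆X∩Y : M ∩ U ⊆ X ∩ Y
      M∩U⊆X∩Y = ⊆-reflexive M∩U≡X∩Y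

      M≡ : M ≡ splice M X ∩ splice M Y
      M≡ = begin
        M                         ≡⟨ splice-trace-self M ⟨
        splice M (M ∩ U)          ≡⟨ cong (splice M) M∩U≡X∩Y ⟩
        splice M (X ∩ Y)          ≡⟨ splice-∩ M X Y ⟩
        splice M X ∩ splice M Y   ∎

      trace : ∀ {Z} → Z ⊆ U → M ≡ splice M Z → M ∩ U ≡ Z
      trace Z⊆U M≡spliceMZ = trans (cong (_∩ U) M≡spliceMZ) (splice-trace Z⊆U)

  MeetIrreducible⇒Max-Ext : ∀ {M} → MeetIrreducible ⊤ 𝒞 M → U ⊈ M → Max (Ext 𝒞 U (M ∩ U)) M
  MeetIrreducible⇒Max-Ext {M} (𝒞M , _ , irr) U⊈M = (𝒞M , refl) , maximal
    where
    maximal : ∀ C → Ext 𝒞 U (M ∩ U) C → M ⊆ C → C ≡ M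
    maximal C (𝒞C , C∩U≡M∩U) M⊆C
      with irr C (splice M U) 𝒞C (splice-closed 𝒞M 𝒞U ⊆-refl (p∩q⊆q M U)) M≡
      where
      M≡ : M ≡ C ∩ splice M U
      M≡ = begin
        M                           ≡⟨ splice-trace-self M ⟨
        (M ∩ ∁ U) ∪ (M ∩ U)         ≡⟨ cong₂ _∪_ (p⊆q⇒q∩p≡p M∩∁U⊆C) C∩U≡M∩U ⟨
        (C ∩ (M ∩ ∁ U)) ∪ (C ∩ U)   ≡⟨ ∩-distribˡ-∪ C (M ∩ ∁ U) U ⟨
        C ∩ splice M U              ∎
        where
        M∩∁U⊆C : M ∩ ∁ U ⊆ C
        M∩∁U⊆C = ⊆-trans (p∩q⊆p M (∁ U)) M⊆C
    ... | inj₁ M≡C       = sym M≡C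
    ... | inj₂ M≡spliceMU = ⊥-elim (U⊈M (subst (U ⊆_) (sym M≡spliceMU) (q⊆p∪q (M ∩ ∁ U) U)))

  Max-Ext⇒MeetIrreducible : ∀ {M₂ M} → MeetIrreducible U (𝒞₂ 𝒞 U) M₂ → Max (Ext 𝒞 U M₂) M →
                            MeetIrreducible ⊤ 𝒞 M
  Max-Ext⇒MeetIrreducible {M₂} {M} (_ , M₂≢U , irr₂) ((𝒞M , M∩U≡M₂) , maximal) = 𝒞M , M≢⊤ , irr
    where
    M≢⊤ : M ≢ ⊤
    M≢⊤ refl = M₂≢U (trans (sym M∩U≡M₂) (∩-identityˡ U))

    irr : ∀ A B → 𝒞 A → 𝒞 B → M ≡ A ∩ B → M ≡ A ⊎ M ≡ B
    irr A B 𝒞A 𝒞B M≡A∩B =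
      Sum.map (enlarge 𝒞A (p∩q⊆p A B)) (enlarge 𝒞B (p∩q⊆q A B))
        (irr₂ (A ∩ U) (B ∩ U) (trace-closed 𝒞A) (trace-closed 𝒞B) M₂≡)
      where
      M₂≡ : M₂ ≡ (A ∩ U) ∩ (B ∩ U)
      M₂≡ = begin
        M₂                  ≡⟨ M∩U≡M₂ ⟨
        M ∩ U               ≡⟨ cong (_∩ U) M≡A∩B ⟩
        (A ∩ B) ∩ U         ≡⟨ ∩-distribʳ-∩ A B U ⟩
        (A ∩ U) ∩ (B ∩ U)   ∎

      enlarge : ∀ {C} → 𝒞 C → A ∩ B ⊆ C → M₂ ≡ C ∩ U → M ≡ C
      enlarge {C} 𝒞C A∩B⊆C M₂≡C∩U =
        sym (maximal C (𝒞C , sym M₂≡C∩U) (subst (_⊆ C) (sym M≡A∩B) A∩B⊆C))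

  FromSplitMeetIrreducible : Subset n → Set
  FromSplitMeetIrreducible M =
    (∃ λ M₁ → MeetIrreducible (∁ U) (𝒞₁ 𝒞 (∁ U) U) M₁ × M ≡ M₁ ∪ U)
    ⊎
    (∃ λ M₂ → MeetIrreducible U (𝒞₂ 𝒞 U) M₂ × Max (Ext 𝒞 U M₂) M)

  MeetIrreducible⇔ : ∀ M → MeetIrreducible ⊤ 𝒞 M ⇔ FromSplitMeetIrreducible M
  MeetIrreducible⇔ M = mk⇔ classify combine
    where
    classify : MeetIrreducible ⊤ 𝒞 M → FromSplitMeetIrreducible M
    classify MI@(𝒞M , _) with U ⊆? M
    ... | yes U⊆M = inj₁ (M ∩ ∁ U , Upper.MeetIrreducible-to MI↑ , sym (Upper.from∘to (𝒞M , U⊆M)))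
      where
      MI↑ : MeetIrreducible ⊤ (Above 𝒞 U) M
      MI↑ = Equivalence.to (MeetIrreducible-Above U⊆M) MI
    ... | no U⊈M  = inj₂ (M ∩ U , trace-MeetIrreducible MI U⊈M , MeetIrreducible⇒Max-Ext MI U⊈M)

    combine : FromSplitMeetIrreducible M → MeetIrreducible ⊤ 𝒞 M
    combine (inj₁ (M₁ , MI₁ , refl)) = union-MeetIrreducible MI₁
    combine (inj₂ (M₂ , MI₂ , max))  = Max-Ext⇒MeetIrreducible MI₂ max

  Ext? : ∀ M₂ → Decidable (Ext 𝒞 U M₂)
  Ext? M₂ C = IsBaseFor⇒Decidable base C ×-dec ≡-dec _≟ᵇ_ (C ∩ U) M₂

  -- Ext M₂ is nonempty for M₂ ∈ 𝒞₂; the fallback M₂ is never used there.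
  maximalExtension : Subset n → Subset n
  maximalExtension M₂ with Ext? M₂ M₂
  ... | yes M₂∈Ext = proj₁ (Max-exists (Ext? M₂) M₂∈Ext)
  ... | no _       = M₂

  maximalExtension-Max : ∀ {M₂} → 𝒞₂ 𝒞 U M₂ → Max (Ext 𝒞 U M₂) (maximalExtension M₂)
  maximalExtension-Max {M₂} (𝒞M₂ , M₂⊆U) with Ext? M₂ M₂
  ... | yes M₂∈Ext = proj₂ (Max-exists (Ext? M₂) M₂∈Ext)
  ... | no M₂∉Ext  = contradiction (𝒞M₂ , p⊆q⇒p∩q≡p M₂⊆U) M₂∉Ext

  maximalExtension-trace : ∀ {M₂} → 𝒞₂ 𝒞 U M₂ → maximalExtension M₂ ∩ U ≡ M₂
  maximalExtension-trace 𝒞₂M₂ = proj₂ (proj₁ (maximalExtension-Max 𝒞₂M₂))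

  meetIrreducible-count : ∀ {k k₁ k₂} →
    HasCard (MeetIrreducible ⊤ 𝒞) k →
    HasCard (MeetIrreducible (∁ U) (𝒞₁ 𝒞 (∁ U) U)) k₁ →
    HasCard (MeetIrreducible U (𝒞₂ 𝒞 U)) k₂ →
    k₁ + k₂ ≤ k
  meetIrreducible-count = HasCard-+-≤ (_∪ U) maximalExtension
    union-MeetIrreducible
    (λ MI₂ → Max-Ext⇒MeetIrreducible MI₂ (maximalExtension-Max (proj₁ MI₂)))
    (λ MI₁ MI₁′ → Upper.from-injective (proj₁ MI₁) (proj₁ MI₁′))
    (λ MI₂ MI₂′ eq → trans (sym (maximalExtension-trace (proj₁ MI₂)))
                           (trans (cong (_∩ U) eq) (maximalExtension-trace (proj₁ MI₂′))))
    (λ {M₁} {M₂} _ (𝒞₂M₂ , M₂≢U , _) M₁∪U≡ →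
       M₂≢U (trans (sym (maximalExtension-trace 𝒞₂M₂))
                   (p⊆q⇒q∩p≡p (subst (U ⊆_) M₁∪U≡ (q⊆p∪q M₁ U)))))

theorem5 : ∀ {n : ℕ} (𝒞 : Family n) (U₁ U₂ : Subset n) →
    ClosureSystem 𝒞 → Standard 𝒞 → AcyclicSplit 𝒞 U₁ U₂ →
    (∀ (k k₁ k₂ : ℕ) →
      HasCard (MeetIrreducible ⊤ 𝒞) k →
      HasCard (MeetIrreducible U₁ (𝒞₁ 𝒞 U₁ U₂)) k₁ →
      HasCard (MeetIrreducible U₂ (𝒞₂ 𝒞 U₂)) k₂ →
      k₁ + k₂ ≤ k)
    ×
    (∀ (M : Subset n) →
      MeetIrreducible ⊤ 𝒞 M ⇔
        ((∃ λ M₁ → MeetIrreducible U₁ (𝒞₁ 𝒞 U₁ U₂) M₁ × M ≡ M₁ ∪ U₂)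
         ⊎
         (∃ λ M₂ → MeetIrreducible U₂ (𝒞₂ 𝒞 U₂) M₂ × Max (Ext 𝒞 U₂ M₂) M)))
theorem5 𝒞 U₁ U₂ closure _ (refl , _ , _ , 𝒞U₂ , _ , base , premise-split , _) =
  (λ _ _ _ → meetIrreducible-count) , MeetIrreducible⇔
  where open SplitClosureSystem closure 𝒞U₂ base premise-split
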